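{- Let $F$ be a sequence of nonempty finite sets, $\mathcal U$ a nonprincipal selective ultrafilter on $\mathbb N$, and $g:\mathbb N\to\mathbb N$ with $g(n)\neq 0$ for all $n$. Let $\mathcal H=\mathcal H(\mathcal U,F,g)=\{A\subseteq\mathbb N(F):\lim_{n\to\mathcal U}\frac{|A(n)|}{g(n)}=\infty\}$. If $\lim_{n\to\infty}\frac{g(n)}{|F(n)|}=0$, then $\mathcal H$ is a nonempty selective coideal on $\mathbb N(F)$.
   Context: $\mathbb N(F)$ is the set of pairs $(n,x)$ with $n\in\mathbb N$ and $x\in F(n)$. For $A\subseteq\mathbb N(F)$, $A(n)=\{x:(n,x)\in A\}$, $\mathrm{dom}(A)=\{n:A(n)\ne\emptyset\}$, and for $k\in\mathbb N$, $A-k=\{(n,x)\in A:n>k\}$. $\lim_{n\to\mathcal U}$ denotes the limit along the ultrafilter $\mathcal U$ (in $[0,\infty]$). A coideal on $\mathbb N(F)$ is the complement of a proper ideal of subsets of $\mathbb N(F)$ containing the finite sets (an upward-closed family such that $A\cup B$ in it implies $A$ or $B$ in it). $B\subseteq\mathbb N(F)$ diagonalizes a sequence $(B_k:k\in\mathbb N)$ of subsets of $\mathbb N(F)$ if $B-k\subseteq B_k$ whenever $k\in\mathrm{dom}(B)$. A coideal $\mathcal H$ on $\mathbb N(F)$ is selective if every descending sequence $A_0\supseteq A_1\supseteq\cdots$ of members of $\mathcal H$ has a diagonalization in $\mathcal H$. -}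

module Defs where

open import Level using (0ℓ)
open import Data.Nat using (ℕ; zero; suc; _+_; _*_; _<_; _≤_; _<ᵇ_)
open import Data.Fin using (Fin)
import Data.Fin as Fin
open import Data.Bool using (Bool; true; false; _∨_; not; if_then_else_)
open import Data.Product using (Σ; ∃; _×_; _,_)
open import Data.Sum using (_⊎_)
open import Relation.Binary.PropositionalEquality using (_≡_; _≢_)
open import Relation.Nullary using (¬_)

-- Subsets are represented by characteristic functions into Bool
-- (classical power set = 2^X).

SubsetN : Set
SubsetN = ℕ → Bool

_⊆ₙ_ : SubsetN → SubsetN → Set
A ⊆ₙ B = ∀ n → A n ≡ true → B n ≡ true

complementₙ : SubsetN → SubsetN
complementₙ A n = not (A n)

_∩ₙ_ : SubsetN → SubsetN → SubsetN
(A ∩ₙ B) n = if A n then B n else false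

singletonₙ : ℕ → SubsetN
singletonₙ m n = if m Data.Nat.≡ᵇ n then true else false

record IsUltrafilter (U : SubsetN → Set) : Set₁ where
  field
    full     : U (λ _ → true)
    no-empty : ¬ U (λ _ → false)
    upward   : ∀ A B → A ⊆ₙ B → U A → U B
    inter    : ∀ A B → U A → U B → U (A ∩ₙ B)
    ultra    : ∀ A → U A ⊎ U (complementₙ A)

NonPrincipal : (SubsetN → Set) → Set
NonPrincipal U = ∀ n → ¬ U (singletonₙ n)

DiagonalizesN : SubsetN → (ℕ → SubsetN) → Set
DiagonalizesN B Bs = ∀ k → B k ≡ true → ∀ n → k < n → B n ≡ true → Bs k n ≡ true

-- Selective (in the sense of the paper: every descending sequence of members
-- has a diagonalization which is a member)
SelectiveN : (SubsetN → Set) → Set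
SelectiveN U = (Bs : ℕ → SubsetN) → (∀ k → U (Bs k)) →
  (∀ k → Bs (suc k) ⊆ₙ Bs k) → Σ SubsetN (λ B → U B × DiagonalizesN B Bs)

-- ℕ(F), where F(n) = Fin (f n) (a finite set of size f n)

Subset : (ℕ → ℕ) → Set
Subset f = (n : ℕ) → Fin (f n) → Bool

module _ {f : ℕ → ℕ} where

  _⊆_ : Subset f → Subset f → Set
  A ⊆ B = ∀ n x → A n x ≡ true → B n x ≡ true

  _∪_ : Subset f → Subset f → Subset f
  (A ∪ B) n x = A n x ∨ B n x

  _-_ : Subset f → ℕ → Subset f
  (A - k) n x = if k <ᵇ n then A n x else false

  _∈dom_ : ℕ → Subset f → Set
  k ∈dom A = ∃ λ x → A k x ≡ true

  -- A is finite (F(n) are finite, so: bounded domain)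
  Finite : Subset f → Set
  Finite A = ∃ λ m → ∀ n x → A n x ≡ true → n < m

  Diagonalizes : Subset f → (ℕ → Subset f) → Set
  Diagonalizes B Bs = ∀ k → k ∈dom B → (B - k) ⊆ Bs k

  -- Coideal: complement of a proper ideal containing the finite sets
  record IsCoideal (H : Subset f → Set) : Set₁ where
    field
      full       : H (λ _ _ → true)
      no-finite  : ∀ A → Finite A → ¬ H A
      upward     : ∀ A B → A ⊆ B → H A → H B
      union      : ∀ A B → H (A ∪ B) → H A ⊎ H B

  Selective : (Subset f → Set) → Set
  Selective H = (Bs : ℕ → Subset f) → (∀ k → H (Bs k)) →
    (∀ k → Bs (suc k) ⊆ Bs k) → Σ (Subset f) (λ B → H B × Diagonalizes B Bs)

card : ∀ {m} → (Fin m → Bool) → ℕ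
card {zero} A = 0
card {suc m} A = (if A Fin.zero then 1 else 0) + card {m} (λ x → A (Fin.suc x))

-- lim_{n → U} |A(n)| / g(n) = ∞  (g(n) > 0):
-- for every bound M, {n : |A(n)| / g(n) > M} ∈ U
ℋ : (U : SubsetN → Set) (f : ℕ → ℕ) (g : ℕ → ℕ) → Subset f → Set
ℋ U f g A = ∀ (M : ℕ) → U (λ n → (M * g n) <ᵇ card (A n))

-- lim_{n → ∞} g(n) / |F(n)| = 0: for every k, eventually g(n)/f(n) < 1/(k+1)
RatioToZero : (g f : ℕ → ℕ) → Set
RatioToZero g f = ∀ (k : ℕ) → ∃ λ N → ∀ n → N ≤ n → suc k * g n < f n

-- ℋ is a coideal because U is a nonprincipal ultrafilter and fibre cardinality is monotone and
-- subadditive; ℋ(ℕ(F)) holds since g(n)/|F(n)| → 0. For selectivity, given descending Bₖ ∈ ℋ,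
-- the sets Cₖ = {n : |Bₖ(n)| > k·g(n)} descend in U, so selectivity of U yields D ∈ U diagonalizing
-- them; then B(n) = B_{p(n)}(n) for n ∈ D, where p(n) is the element of D just below n, both
-- diagonalizes (Bₖ) and satisfies |B(n)| > p(n)·g(n) with p(n) → ∞ along D.
module Submission where

open import Defs
open import Level using (0ℓ)
open import Axiom.ExcludedMiddle using (ExcludedMiddle)
open import Axiom.DoubleNegationElimination using (em⇒dne)
open import Data.Nat using (ℕ; zero; suc; _+_; _*_; _≤_; _<_; _≤′_; ≤′-refl; ≤′-step; _<ᵇ_; _≡ᵇ_; z≤n; s≤s; s≤s⁻¹; _<?_)
open import Data.Nat.Properties
open import Data.Fin using (Fin)
import Data.Fin as Fin
open import Data.Bool using (Bool; true; false; _∨_; not; if_then_else_; T)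
open import Data.Bool.Properties using (T-≡)
open import Data.Product using (∃; _×_; _,_; proj₁; proj₂)
open import Data.Sum using (_⊎_; inj₁; inj₂; [_,_]′)
import Data.Sum as Sum
open import Data.Empty using (⊥; ⊥-elim)
open import Function using (_∘_)
open import Function.Bundles using (Equivalence)
open import Relation.Nullary using (¬_; yes; no; contradiction)
open import Relation.Binary.PropositionalEquality using (_≡_; _≢_; refl; sym; trans; cong; subst)

<ᵇ≡true⇒< : ∀ {m n} → (m <ᵇ n) ≡ true → m < n
<ᵇ≡true⇒< {m} {n} = <ᵇ⇒< m n ∘ Equivalence.from T-≡

<⇒<ᵇ≡true : ∀ {m n} → m < n → (m <ᵇ n) ≡ true
<⇒<ᵇ≡true = Equivalence.to T-≡ ∘ <⇒<ᵇ

true∧not⇒⊥ : ∀ {b} → b ≡ true → not b ≡ true → ⊥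
true∧not⇒⊥ refl ()

∩ₙ-elim : ∀ (X Y : SubsetN) n → (X ∩ₙ Y) n ≡ true → X n ≡ true × Y n ≡ true
∩ₙ-elim X Y n eq with X n
... | true  = refl , eq
... | false = contradiction eq λ ()

¬∀⇒∃¬ : ExcludedMiddle 0ℓ → (P : ℕ → Set) → ¬ (∀ M → P M) → ∃ λ M → ¬ P M
¬∀⇒∃¬ em P ¬∀P = em⇒dne em λ ¬∃ → ¬∀P λ M → em⇒dne em λ ¬PM → ¬∃ (M , ¬PM)

+-<-+⇒<⊎< : ∀ {a b x y} → a + b < x + y → a < x ⊎ b < y
+-<-+⇒<⊎< {a} {b} {x} {y} lt with a <? x | b <? y
... | yes a<x | _       = inj₁ a<x
... | no _    | yes b<y = inj₂ b<y
... | no a≮x  | no b≮y  = contradiction lt (≤⇒≯ (+-mono-≤ (≮⇒≥ a≮x) (≮⇒≥ b≮y)))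

card-mono : ∀ {m} (A B : Fin m → Bool) → (∀ x → A x ≡ true → B x ≡ true) → card A ≤ card B
card-mono {zero}  A B A⊆B = z≤n
card-mono {suc m} A B A⊆B
  with A Fin.zero in eqA | B Fin.zero in eqB | card-mono (A ∘ Fin.suc) (B ∘ Fin.suc) (A⊆B ∘ Fin.suc)
... | true  | true  | rest = s≤s rest
... | true  | false | _    = contradiction (trans (sym (A⊆B Fin.zero eqA)) eqB) λ ()
... | false | true  | rest = m≤n⇒m≤1+n rest
... | false | false | rest = rest

card-∨ : ∀ {m} (A B : Fin m → Bool) → card (λ x → A x ∨ B x) ≤ card A + card B
card-∨ {zero}  A B = z≤n
card-∨ {suc m} A B with A Fin.zero | B Fin.zero | card-∨ (A ∘ Fin.suc) (B ∘ Fin.suc)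
... | true  | true  | rest = s≤s (≤-trans rest (+-monoʳ-≤ (card (A ∘ Fin.suc)) (n≤1+n _)))
... | true  | false | rest = s≤s rest
... | false | true  | rest rewrite +-suc (card (A ∘ Fin.suc)) (card (B ∘ Fin.suc)) = s≤s rest
... | false | false | rest = rest

card-empty : ∀ {m} (A : Fin m → Bool) → (∀ x → A x ≢ true) → card A ≡ 0
card-empty {zero}  A A-empty = refl
card-empty {suc m} A A-empty with A Fin.zero in eqA
... | true  = contradiction eqA (A-empty Fin.zero)
... | false = card-empty (A ∘ Fin.suc) (A-empty ∘ Fin.suc)

card-full : ∀ m → card {m} (λ _ → true) ≡ m
card-full zero    = refl
card-full (suc m) = cong suc (card-full m)

module UltrafilterProperties {U : SubsetN → Set} (uf : IsUltrafilter U) where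
  open IsUltrafilter uf

  ∈-disjoint-⊥ : ∀ X Y → U X → U Y → (∀ n → X n ≡ true → Y n ≡ true → ⊥) → ⊥
  ∈-disjoint-⊥ X Y X∈ Y∈ disjoint = no-empty (upward _ _ X∩Y⊆∅ (inter X Y X∈ Y∈))
    where
    X∩Y⊆∅ : (X ∩ₙ Y) ⊆ₙ (λ _ → false)
    X∩Y⊆∅ n eq = ⊥-elim (disjoint n (proj₁ (∩ₙ-elim X Y n eq)) (proj₂ (∩ₙ-elim X Y n eq)))

  ∈-⊎ : ∀ X Y Z → U X → (∀ n → X n ≡ true → Y n ≡ true ⊎ Z n ≡ true) → U Y ⊎ U Z
  ∈-⊎ X Y Z X∈ X⊆Y∪Z with ultra Y | ultra Z
  ... | inj₁ Y∈  | _        = inj₁ Y∈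
  ... | inj₂ _   | inj₁ Z∈  = inj₂ Z∈
  ... | inj₂ Yᶜ∈ | inj₂ Zᶜ∈ = ⊥-elim (∈-disjoint-⊥ (X ∩ₙ complementₙ Y) (complementₙ Z)
      (inter X (complementₙ Y) X∈ Yᶜ∈) Zᶜ∈ disjoint)
    where
    disjoint : ∀ n → (X ∩ₙ complementₙ Y) n ≡ true → complementₙ Z n ≡ true → ⊥
    disjoint n eq Zᶜn with ∩ₙ-elim X (complementₙ Y) n eq
    ... | Xn , Yᶜn with X⊆Y∪Z n Xn
    ... | inj₁ Yn = true∧not⇒⊥ Yn Yᶜn
    ... | inj₂ Zn = true∧not⇒⊥ Zn Zᶜn

  module _ (np : NonPrincipal U) where

    ∈-add-point⇒∈ : ∀ N X → U (λ n → singletonₙ N n ∨ X n) → U X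
    ∈-add-point⇒∈ N X X+N∈ = [ (λ N∈ → contradiction N∈ (np N)) , (λ X∈ → X∈) ]′
      (∈-⊎ _ (singletonₙ N) X X+N∈ λ n eq → split (singletonₙ N n) eq)
      where
      split : ∀ {x} a → (a ∨ x) ≡ true → a ≡ true ⊎ x ≡ true
      split true  _  = inj₁ refl
      split false eq = inj₂ eq

    cofinite∈ : ∀ N X → (∀ n → N ≤ n → X n ≡ true) → U X
    cofinite∈ zero    X in-X = upward _ _ (λ n _ → in-X n z≤n) full
    cofinite∈ (suc N) X in-X = ∈-add-point⇒∈ N X (cofinite∈ N _ in-X+N)
      where
      in-X+N : ∀ n → N ≤ n → (singletonₙ N n ∨ X n) ≡ true
      in-X+N n N≤n with N ≡ᵇ n in eq | m≤n⇒m<n∨m≡n N≤n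
      ... | true  | _         = refl
      ... | false | inj₁ N<n  = in-X n N<n
      ... | false | inj₂ refl = contradiction (≡⇒≡ᵇ N N refl) (subst T eq)

    bounded∉ : ∀ m X → U X → (∀ n → X n ≡ true → n < m) → ⊥
    bounded∉ m X X∈ X-below-m = ∈-disjoint-⊥ X (complementₙ X) X∈ (cofinite∈ m _ in-Xᶜ) λ _ → true∧not⇒⊥
      where
      in-Xᶜ : ∀ n → m ≤ n → complementₙ X n ≡ true
      in-Xᶜ n m≤n with X n in eq
      ... | true  = contradiction m≤n (<⇒≱ (X-below-m n eq))
      ... | false = refl

    ∈⇒unbounded : ExcludedMiddle 0ℓ → ∀ X → U X → ∀ M → ∃ λ n → X n ≡ true × M ≤ n
    ∈⇒unbounded em X X∈ M with em {∃ λ n → X n ≡ true × M ≤ n}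
    ... | yes witness = witness
    ... | no ¬witness = ⊥-elim (bounded∉ M X X∈ λ n Xn → ≰⇒> λ M≤n → ¬witness (n , Xn , M≤n))

lastBelow : SubsetN → ℕ → ℕ
lastBelow D zero    = 0
lastBelow D (suc n) = if D n then n else lastBelow D n

lastBelow-spec : ∀ D n k → D k ≡ true → k < n →
                 D (lastBelow D n) ≡ true × lastBelow D n < n × k ≤ lastBelow D n
lastBelow-spec D (suc n) k Dk k<1+n with D n in Dn | m≤n⇒m<n∨m≡n (s≤s⁻¹ k<1+n)
... | true  | _         = Dn , ≤-refl , s≤s⁻¹ k<1+n
... | false | inj₂ refl = contradiction (trans (sym Dk) Dn) λ ()
... | false | inj₁ k<n with lastBelow-spec D n k Dk k<n
...   | Dp , p<n , k≤p = Dp , m<n⇒m<1+n p<n , k≤p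

module _ {f : ℕ → ℕ} where

  Descending : (ℕ → Subset f) → Set
  Descending Bs = ∀ k → Bs (suc k) ⊆ Bs k

  Descending⇒antitone : ∀ {Bs} → Descending Bs → ∀ {k j} → k ≤′ j → Bs j ⊆ Bs k
  Descending⇒antitone desc ≤′-refl          n x Bjnx = Bjnx
  Descending⇒antitone desc (≤′-step k≤′j) n x Bjnx = Descending⇒antitone desc k≤′j n x (desc _ n x Bjnx)

  diagonal : (ℕ → Subset f) → SubsetN → Subset f
  diagonal Bs D n = if D n then Bs (lastBelow D n) n else λ _ → false

  diagonal-∈ : ∀ Bs D n → D n ≡ true → diagonal Bs D n ≡ Bs (lastBelow D n) n
  diagonal-∈ Bs D n Dn rewrite Dn = refl

  diagonal-dom : ∀ Bs D n x → diagonal Bs D n x ≡ true → D n ≡ true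
  diagonal-dom Bs D n x eq with D n
  ... | true  = refl
  ... | false = eq

  diagonal-diagonalizes : ∀ Bs D → Descending Bs → Diagonalizes (diagonal Bs D) Bs
  diagonal-diagonalizes Bs D desc k (y , Bky) n x eq with k <ᵇ n in k<ᵇn | D n in Dn
  ... | false | _     = contradiction eq λ ()
  ... | true  | false = contradiction eq λ ()
  ... | true  | true  = Descending⇒antitone desc (≤⇒≤′ k≤p) n x eq
    where k≤p = proj₂ (proj₂ (lastBelow-spec D n k (diagonal-dom Bs D k y Bky) (<ᵇ≡true⇒< k<ᵇn)))

module _ {U : SubsetN → Set} (uf : IsUltrafilter U) (np : NonPrincipal U) {f : ℕ → ℕ} (g : ℕ → ℕ) where
  open IsUltrafilter uf
  open UltrafilterProperties uf

  Large : Subset f → ℕ → SubsetN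
  Large A M n = M * g n <ᵇ card (A n)

  Large-mono : ∀ {A B M M′} → A ⊆ B → M ≤ M′ → Large A M′ ⊆ₙ Large B M
  Large-mono {A} {B} A⊆B M≤M′ n eq = <⇒<ᵇ≡true (≤-<-trans (*-monoˡ-≤ (g n) M≤M′)
    (<-≤-trans (<ᵇ≡true⇒< eq) (card-mono (A n) (B n) (A⊆B n))))

  Large-∪ : ∀ A B M₁ M₂ n → Large (A ∪ B) (M₁ + M₂) n ≡ true →
            Large A M₁ n ≡ true ⊎ Large B M₂ n ≡ true
  Large-∪ A B M₁ M₂ n eq = Sum.map <⇒<ᵇ≡true <⇒<ᵇ≡true split
    where
    open ≤-Reasoning
    bound : M₁ * g n + M₂ * g n < card (A n) + card (B n)
    bound = begin-strict
      M₁ * g n + M₂ * g n     ≡⟨ *-distribʳ-+ (g n) M₁ M₂ ⟨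
      (M₁ + M₂) * g n         <⟨ <ᵇ≡true⇒< eq ⟩
      card ((A ∪ B) n)        ≤⟨ card-∨ (A n) (B n) ⟩
      card (A n) + card (B n) ∎
    split : M₁ * g n < card (A n) ⊎ M₂ * g n < card (B n)
    split = +-<-+⇒<⊎< bound

  ℋ-full : RatioToZero g f → ℋ U f g (λ _ _ → true)
  ℋ-full ratio M with ratio M
  ... | N , small = cofinite∈ np N _ λ n N≤n → <⇒<ᵇ≡true (begin-strict
    M * g n               ≤⟨ *-monoˡ-≤ (g n) (n≤1+n M) ⟩
    suc M * g n           <⟨ small n N≤n ⟩
    f n                   ≡⟨ card-full (f n) ⟨
    card {f n} (λ _ → true) ∎)
    where open ≤-Reasoning

  ℋ-finite : ∀ A → Finite A → ¬ ℋ U f g A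
  ℋ-finite A (m , A-below-m) A∈ℋ = bounded∉ np m (Large A 0) (A∈ℋ 0) dom-below-m
    where
    dom-below-m : ∀ n → Large A 0 n ≡ true → n < m
    dom-below-m n eq = ≰⇒> λ m≤n →
      m<n⇒n≢0 (<ᵇ≡true⇒< eq) (card-empty (A n) λ x Anx → <⇒≱ (A-below-m n x Anx) m≤n)

  ℋ-upward : ∀ A B → A ⊆ B → ℋ U f g A → ℋ U f g B
  ℋ-upward A B A⊆B A∈ℋ M = upward _ _ (Large-mono {M = M} A⊆B ≤-refl) (A∈ℋ M)

  ℋ-∪ : ExcludedMiddle 0ℓ → ∀ A B → ℋ U f g (A ∪ B) → ℋ U f g A ⊎ ℋ U f g B
  ℋ-∪ em A B A∪B∈ℋ with em {ℋ U f g A} | em {ℋ U f g B}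
  ... | yes A∈ℋ | _       = inj₁ A∈ℋ
  ... | no _    | yes B∈ℋ = inj₂ B∈ℋ
  ... | no A∉ℋ  | no B∉ℋ  with ¬∀⇒∃¬ em _ A∉ℋ | ¬∀⇒∃¬ em _ B∉ℋ
  ...   | M₁ , A∉ | M₂ , B∉ = ⊥-elim ([ A∉ , B∉ ]′ (∈-⊎ _ _ _ (A∪B∈ℋ (M₁ + M₂)) (Large-∪ A B M₁ M₂)))

  ℋ-isCoideal : ExcludedMiddle 0ℓ → RatioToZero g f → IsCoideal (ℋ U f g)
  ℋ-isCoideal em ratio = record
    { full = ℋ-full ratio ; no-finite = ℋ-finite ; upward = ℋ-upward ; union = ℋ-∪ em }

  diagonal∈ℋ : ExcludedMiddle 0ℓ → ∀ Bs D → U D → DiagonalizesN D (λ k → Large (Bs k) k) →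
               ℋ U f g (diagonal Bs D)
  diagonal∈ℋ em Bs D D∈U D-diag M with ∈⇒unbounded np em D D∈U M
  ... | T , DT , M≤T = upward _ _ D-above-T⊆Large
    (inter D (T <ᵇ_) D∈U (cofinite∈ np (suc T) (T <ᵇ_) λ n → <⇒<ᵇ≡true))
    where
    D-above-T⊆Large : (D ∩ₙ (T <ᵇ_)) ⊆ₙ Large (diagonal Bs D) M
    D-above-T⊆Large n eq with ∩ₙ-elim D (T <ᵇ_) n eq
    ... | Dn , T<ᵇn with lastBelow-spec D n T DT (<ᵇ≡true⇒< T<ᵇn)
    ... | Dp , p<n , T≤p = subst (λ S → (M * g n <ᵇ card S) ≡ true) (sym (diagonal-∈ Bs D n Dn))
      (Large-mono {A = Bs p} {M = M} (λ _ _ Bxn → Bxn) (≤-trans M≤T T≤p) n (D-diag p Dp n p<n Dn))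
      where p = lastBelow D n

  ℋ-selective : ExcludedMiddle 0ℓ → SelectiveN U → Selective (ℋ U f g)
  ℋ-selective em selU Bs Bs∈ℋ desc with selU (λ k → Large (Bs k) k) (λ k → Bs∈ℋ k k)
                                            (λ k → Large-mono (desc k) (n≤1+n k))
  ... | D , D∈U , D-diag = diagonal Bs D , diagonal∈ℋ em Bs D D∈U D-diag , diagonal-diagonalizes Bs D desc

proposition4p2 : ExcludedMiddle 0ℓ →
    (f : ℕ → ℕ) → (∀ n → 1 ≤ f n) →
    (U : SubsetN → Set) → IsUltrafilter U → NonPrincipal U → SelectiveN U →
    (g : ℕ → ℕ) → (∀ n → g n ≢ 0) →
    RatioToZero g f →
    (∃ λ A → ℋ U f g A) × IsCoideal (ℋ U f g) × Selective (ℋ U f g)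
proposition4p2 em f _ U uf np selU g _ ratio =
  (_ , ℋ-full uf np g ratio) , ℋ-isCoideal uf np g em ratio , ℋ-selective uf np g em selU
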